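{- Let $(\Sigma,<)$ be a finite totally ordered alphabet and let $w\in\Sigma^+$. If $\mathrm{ICFL}(w)=(m_1,\ldots,m_k)$, then $$\mathrm{CFL}_{in}(w)=(\mathcal{NB}(m_1),\ldots,\mathcal{NB}(m_k)),$$ where the right-hand side denotes the concatenation of the sequences $\mathcal{NB}(m_1),\ldots,\mathcal{NB}(m_k)$.
   Context: Words are elements of the free monoid $\Sigma^*$; $1$ is the empty word and $\Sigma^+=\Sigma^*\setminus\{1\}$. The lexicographic order $\prec$ on $\Sigma^*$: $x\prec y$ if $x$ is a proper prefix of $y$, or $x=ras$, $y=rbt$ with $a,b\in\Sigma$, $a<b$, $r,s,t\in\Sigma^*$. For nonempty $x,y$, $x\ll y$ means $x\prec y$ and $x$ is not a proper prefix of $y$. $x\le_p y$ means $x$ is a prefix of $y$. The inverse order $<_{in}$ on $\Sigma$ is given by $b<_{in}a\iff a<b$, and $\prec_{in}$ is the lexicographic order on $\Sigma^*$ induced by $<_{in}$. An anti-Lyndon word is a Lyndon word with respect to $\prec_{in}$, i.e. a nonempty primitive word that is strictly smaller for $\prec_{in}$ than all its other conjugates. For $w\in\Sigma^+$, $\mathrm{CFL}_{in}(w)$ is the unique sequence $(\ell_1,\ldots,\ell_h)$ of anti-Lyndon words with $w=\ell_1\cdots\ell_h$ and $\ell_1\succeq_{in}\ell_2\succeq_{in}\cdots\succeq_{in}\ell_h$. A border of a nonempty word $x$ is a word that is both a proper prefix and a suffix of $x$; $x$ is bordered if it has a nonempty border, unbordered otherwise. Every bordered word has exactly one nonempty border that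 is unbordered. The sequence $\mathcal{NB}(x)$, $x\in\Sigma^+$, is defined recursively: if $x$ is unbordered, $\mathcal{NB}(x)=(x)$; if $x$ is bordered, let $z$ be its unique nonempty unbordered border and $y\in\Sigma^+$ with $x=yz$; then $\mathcal{NB}(x)=(\mathcal{NB}(y),z)$ (concatenation of the sequence $\mathcal{NB}(y)$ with $z$). An inverse Lyndon word is a word $w\in\Sigma^+$ such that $s\prec w$ for every nonempty proper suffix $s$ of $w$. Let $w\in\Sigma^+$ and let $p$ be an inverse Lyndon word that is a nonempty proper prefix of $w=pv$. A bounded right extension of $p$ (relative to $w$) is a nonempty prefix $\overline{p}$ of $v$ such that: $\overline p$ is an inverse Lyndon word; $pz'$ is an inverse Lyndon word for every proper nonempty prefix $z'$ of $\overline p$; $p\overline p$ is not an inverse Lyndon word; and $p\ll\overline p$. If $w$ is not an inverse Lyndon word, there is exactly one pair $(p,\overline p)$ with $p$ an inverse Lyndon nonempty proper prefix of $w$ and $\overline p$ a bounded right extension of $p$; it is called the canonical pair of $w$. The canonical inverse Lyndon factorization $\mathrm{ICFL}(w)$ is defined recursively: if $w$ is an inverse Lyndon word, $\mathrm{ICFL}(w)=(w)$. Otherwise let $(p,\overline p)$ be the canonical pair of $w$, $w=pv$, write $\overline p=rb$ with $b\in\Sigma$, and let $\mathrm{ICFL}(v)=(m'_1,\ldots,m'_{k'})$; then $\mathrm{ICFL}(w)=(p,m'_1,\ldots,m'_{k'})$ if $\overline p\le_p m'_1$, and $\mathrm{ICFL}(w)=(pm'_1,m'_2,\ldots,m'_{k'})$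 if $m'_1\le_p r$ (exactly one of these two cases occurs). -}

module Defs where

open import Data.Nat using (ℕ; _≥_)
open import Data.Fin using (Fin)
import Data.Fin as F
open import Data.List using (List; []; _∷_; _++_; concat; replicate; [_])
open import Data.List.Relation.Unary.All using (All)
open import Data.List.Relation.Binary.Pointwise using (Pointwise)
open import Data.Product using (Σ; ∃; _×_; _,_)
open import Data.Sum using (_⊎_)
open import Relation.Binary.PropositionalEquality using (_≡_; _≢_)
open import Relation.Nullary using (¬_)

-- The alphabet: a finite totally ordered set, taken (up to order isomorphism)
-- to be Fin n with its usual order.
module Words (n : ℕ) where

  Letter : Set
  Letter = Fin n

  Word : Set
  Word = List Letter

  _<ₗ_ : Letter → Letter → Set
  a <ₗ b = a F.< b

  _<in_ : Letter → Letter → Set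
  a <in b = b F.< a

  data Lex (R : Letter → Letter → Set) : Word → Word → Set where
    lex-prefix : ∀ x t → t ≢ [] → Lex R x (x ++ t)
    lex-diff   : ∀ r a b s t → R a b → Lex R (r ++ a ∷ s) (r ++ b ∷ t)

  _≺_ : Word → Word → Set
  _≺_ = Lex _<ₗ_

  _≺in_ : Word → Word → Set
  _≺in_ = Lex _<in_

  _⪰in_ : Word → Word → Set
  x ⪰in y = (y ≺in x) ⊎ (x ≡ y)

  _≤p_ : Word → Word → Set
  x ≤p y = ∃ λ t → y ≡ x ++ t

  ProperPrefix : Word → Word → Set
  ProperPrefix x y = ∃ λ t → t ≢ [] × y ≡ x ++ t

  ProperSuffix : Word → Word → Set
  ProperSuffix s y = ∃ λ t → t ≢ [] × y ≡ t ++ s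

  _≪_ : Word → Word → Set
  x ≪ y = x ≢ [] × y ≢ [] × x ≺ y × ¬ ProperPrefix x y

  Primitive : Word → Set
  Primitive w = w ≢ [] × ¬ (Σ Word λ x → Σ ℕ λ k → k ≥ 2 × w ≡ concat (replicate k x))

  -- Lyndon w.r.t. ≺in: primitive, strictly ≺in-smaller than every other conjugate
  AntiLyndon : Word → Set
  AntiLyndon w = Primitive w × (∀ u v → w ≡ u ++ v → v ++ u ≢ w → w ≺in (v ++ u))

  data NonIncrIn : List Word → Set where
    nil  : NonIncrIn []
    one  : ∀ x → NonIncrIn [ x ]
    cons : ∀ x y ls → x ⪰in y → NonIncrIn (y ∷ ls) → NonIncrIn (x ∷ y ∷ ls)

  IsCFLin : Word → List Word → Set
  IsCFLin w ls = All AntiLyndon ls × concat ls ≡ w × NonIncrIn ls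

  Border : Word → Word → Set
  Border z x = ProperPrefix z x × ProperSuffix z x

  Unbordered : Word → Set
  Unbordered x = x ≢ [] × (∀ z → Border z x → z ≡ [])

  Bordered : Word → Set
  Bordered x = ∃ λ z → z ≢ [] × Border z x

  data NBRel : Word → List Word → Set where
    nb-unb : ∀ x → Unbordered x → NBRel x [ x ]
    nb-bor : ∀ x y z s → Bordered x → Border z x → Unbordered z →
             x ≡ y ++ z → y ≢ [] → NBRel y s → NBRel x (s ++ [ z ])

  InvLyndon : Word → Set
  InvLyndon w = w ≢ [] × (∀ s → s ≢ [] → ProperSuffix s w → s ≺ w)

  BoundedRightExt : Word → Word → Word → Set
  BoundedRightExt p v pbar =
    pbar ≢ [] × pbar ≤p v × InvLyndon pbar ×
    (∀ z' → z' ≢ [] → ProperPrefix z' pbar → InvLyndon (p ++ z')) ×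
    ¬ InvLyndon (p ++ pbar) × p ≪ pbar

  CanonicalPair : Word → Word → Word → Word → Set
  CanonicalPair w p v pbar =
    ¬ InvLyndon w × w ≡ p ++ v × p ≢ [] × v ≢ [] × InvLyndon p × BoundedRightExt p v pbar

  data ICFLRel : Word → List Word → Set where
    icfl-inv  : ∀ w → InvLyndon w → ICFLRel w [ w ]
    icfl-sep  : ∀ w p v pbar r b m₁ ms → CanonicalPair w p v pbar → pbar ≡ r ++ [ b ] →
                ICFLRel v (m₁ ∷ ms) → pbar ≤p m₁ → ICFLRel w (p ∷ m₁ ∷ ms)
    icfl-glue : ∀ w p v pbar r b m₁ ms → CanonicalPair w p v pbar → pbar ≡ r ++ [ b ] →
                ICFLRel v (m₁ ∷ ms) → m₁ ≤p r → ICFLRel w ((p ++ m₁) ∷ ms)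

{-# OPTIONS --safe #-}
-- Every factor m of ICFL(w) is an inverse Lyndon word, and for such words NB(m) is already a
-- ≺in-nonincreasing sequence of anti-Lyndon words: unbordered inverse Lyndon words are anti-Lyndon,
-- nonempty prefixes and borders of inverse Lyndon words are inverse Lyndon, and if z is the
-- unbordered border of m = y z, the last term z′ of NB(y) is not a proper prefix of z, for otherwise
-- z = z′ t and the inverse Lyndon property of m makes t a border of z.
--
-- It remains to compare consecutive factors. If (p , r b) is the canonical pair, then p = r a t with
-- a < b, and the last term of NB(p) is a prefix of p extending r a, hence ⪰in every prefix of the
-- next factor, which begins with r b. When the next factor m₁ is glued to p instead, m₁ is a border
-- of p m₁, so NB(p m₁) ends with the same term as NB(m₁).
module Submission where

open import Data.Nat using (ℕ; zero; suc; _≤_; _≥_; s≤s)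
import Data.Nat.Properties as ℕ
import Data.Fin.Properties as Fin
open import Data.List using (List; []; _∷_; _++_; _∷ʳ_; concat; replicate; [_]; length)
open import Data.List.Properties
  using (++-assoc; ++-identityʳ; ++-identityˡ-unique; ++-cancelˡ; ++-conicalˡ; ++-conicalʳ;
         ∷ʳ-injective; ∷-injective; concat-++; length-++-≤ˡ; length-++-≤ʳ)
open import Data.List.Relation.Binary.Lex.Strict
  using (Lex-<; halt; this; next; <-transitive; <-asymmetric)
open import Data.List.Relation.Binary.Pointwise using (Pointwise; []; _∷_)
open import Data.List.Relation.Unary.All using (All; []; _∷_)
open import Data.List.Relation.Unary.All.Properties using (++⁺)
open import Data.List.Relation.Unary.Linked using (Linked; []; [-]; _∷_)
open import Data.Product using (Σ; ∃; ∃₂; _×_; _,_; proj₁)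
open import Data.Sum using (_⊎_; inj₁; inj₂)
import Data.Sum as Sum
open import Data.Empty using (⊥-elim)
open import Function using (_∘_)
open import Relation.Binary.PropositionalEquality
  using (_≡_; _≢_; refl; sym; trans; cong; cong₂; subst; subst₂; isEquivalence; module ≡-Reasoning)
open import Relation.Nullary using (¬_)

open import Defs

module _ {n : ℕ} where
  open Words n

  private
    variable
      a b : Letter
      c f m p r s t u w x y z z′ S : Word
      ws ms : List Word
      wss : List (List Word)
      v p̄ : Word

  _≤s_ : Word → Word → Set
  x ≤s y = ∃ λ t → y ≡ t ++ x

  levi : ∀ (x y u v : Word) → x ++ y ≡ u ++ v →
         (∃ λ e → u ≡ x ++ e × y ≡ e ++ v) ⊎ (∃ λ e → x ≡ u ++ e × v ≡ e ++ y)
  levi [] y u v eq = inj₁ (u , refl , eq)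
  levi (a ∷ x) y [] v eq = inj₂ (a ∷ x , refl , sym eq)
  levi (a ∷ x) y (b ∷ u) v eq with ∷-injective eq
  ... | refl , eq′ with levi x y u v eq′
  ...   | inj₁ (e , refl , q) = inj₁ (e , refl , q)
  ...   | inj₂ (e , refl , q) = inj₂ (e , refl , q)

  ≤p-refl : ∀ x → x ≤p x
  ≤p-refl x = [] , sym (++-identityʳ x)

  ≤p-trans : x ≤p y → y ≤p z → x ≤p z
  ≤p-trans {x} (t , refl) (u , refl) = t ++ u , ++-assoc x t u

  ∷-≤p : x ≤p y → (a ∷ x) ≤p (a ∷ y)
  ∷-≤p {a = a} (t , e) = t , cong (a ∷_) e

  ≤p-total : x ≤p w → y ≤p w → x ≤p y ⊎ y ≤p x
  ≤p-total {x} {y = y} (t , refl) (u , e) with levi x t y u e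
  ... | inj₁ (g , y≡xg , _) = inj₁ (g , y≡xg)
  ... | inj₂ (g , x≡yg , _) = inj₂ (g , x≡yg)

  ≤s-refl : ∀ x → x ≤s x
  ≤s-refl x = [] , refl

  ≤s-total : x ≤s w → y ≤s w → x ≤s y ⊎ y ≤s x
  ≤s-total {x} {y = y} (t , refl) (u , e) with levi t x u y e
  ... | inj₁ (g , _ , x≡gy) = inj₂ (g , x≡gy)
  ... | inj₂ (g , _ , y≡gx) = inj₁ (g , y≡gx)

  ≤p-∷ʳ : x ≤p (y ∷ʳ b) → x ≤p y ⊎ x ≡ y ∷ʳ b
  ≤p-∷ʳ {x} {y} {b} (t , e) with levi y [ b ] x t e
  ... | inj₁ ([] , x≡y[] , _) =
    inj₁ (subst (_≤p y) (sym (trans x≡y[] (++-identityʳ y))) (≤p-refl y))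
  ... | inj₁ (_ ∷ [] , refl , refl) = inj₂ refl
  ... | inj₁ (_ ∷ _ ∷ _ , _ , ())
  ... | inj₂ (g , y≡xg , _) = inj₁ (g , y≡xg)

  ∷ʳ≢[] : ∀ x → x ∷ʳ b ≢ []
  ∷ʳ≢[] [] ()
  ∷ʳ≢[] (_ ∷ _) ()

  ∷ʳ-≤p : p ≡ r ++ a ∷ t → (r ∷ʳ a) ≤p p
  ∷ʳ-≤p {r = r} {a} {t} p≡rat = t , trans p≡rat (sym (++-assoc r [ a ] t))

  ≤p⇒ProperPrefix-∷ʳ : x ≤p r → ProperPrefix x (r ∷ʳ b)
  ≤p⇒ProperPrefix-∷ʳ {x} {b = b} (g , refl) = g ∷ʳ b , ∷ʳ≢[] g , ++-assoc x g [ b ]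

  ProperSuffix⇒≰p : ProperSuffix s y → ¬ (y ≤p s)
  ProperSuffix⇒≰p ([] , c≢[] , _) = ⊥-elim (c≢[] refl)
  ProperSuffix⇒≰p {s} (_ ∷ c , _ , refl) y≤s =
    ℕ.<⇒≱ (s≤s (length-++-≤ʳ s {c})) (≤p-length y≤s)
    where
    ≤p-length : x ≤p y → length x ≤ length y
    ≤p-length {x} (t , refl) = length-++-≤ˡ x

  ≤s⇒≤p : y ≤s x → x ≤p w → y ≤p w → y ≤p x
  ≤s⇒≤p {y} y≤sx x≤w y≤w with ≤p-total y≤w x≤w
  ... | inj₁ y≤x = y≤x
  ... | inj₂ x≤y with y≤sx
  ...   | [] , refl = ≤p-refl y
  ...   | d ∷ c , refl = ⊥-elim (ProperSuffix⇒≰p (d ∷ c , (λ ()) , refl) x≤y)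

  unbordered-prefix-¬properSuffix : Unbordered z → m ≢ [] → m ≤p z → ¬ ProperSuffix m z
  unbordered-prefix-¬properSuffix {m = m} _ _ ([] , z≡m[]) (c , c≢[] , z≡cm) =
    c≢[] (++-identityˡ-unique c (trans (sym (trans z≡m[] (++-identityʳ m))) z≡cm))
  unbordered-prefix-¬properSuffix (_ , noBorder) m≢[] (d ∷ t , z≡mdt) suffix =
    m≢[] (noBorder _ ((d ∷ t , (λ ()) , z≡mdt) , suffix))

  _<lex_ : Word → Word → Set
  _<lex_ = Lex-< _≡_ _<ₗ_

  <lex-trans : x <lex y → y <lex z → x <lex z
  <lex-trans = <-transitive isEquivalence Fin.<-resp₂-≡ Fin.<-trans

  <lex-asym : x <lex y → ¬ (y <lex x)
  <lex-asym = <-asymmetric sym Fin.<-resp₂-≡ Fin.<-asym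

  <lex-irrefl : ¬ (x <lex x)
  <lex-irrefl x<x = <lex-asym x<x x<x

  ++-<lex : ∀ x {t : Word} → t ≢ [] → x <lex (x ++ t)
  ++-<lex [] {[]} t≢[] = ⊥-elim (t≢[] refl)
  ++-<lex [] {_ ∷ _} _ = halt
  ++-<lex (a ∷ x) t≢[] = next refl (++-<lex x t≢[])

  <lex-++ˡ : ∀ r → x <lex y → (r ++ x) <lex (r ++ y)
  <lex-++ˡ [] h = h
  <lex-++ˡ (a ∷ r) h = next refl (<lex-++ˡ r h)

  <lex-cancelˡ : ∀ r → (r ++ x) <lex (r ++ y) → x <lex y
  <lex-cancelˡ [] h = h
  <lex-cancelˡ (a ∷ r) (this a<a) = ⊥-elim (Fin.<-irrefl refl a<a)
  <lex-cancelˡ (a ∷ r) (next _ h) = <lex-cancelˡ r h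

  ≺⇒<lex : x ≺ y → x <lex y
  ≺⇒<lex (lex-prefix x t t≢[]) = ++-<lex x t≢[]
  ≺⇒<lex (lex-diff r a b s t a<b) = <lex-++ˡ r (this a<b)

  ∷-≺ : x ≺ y → (a ∷ x) ≺ (a ∷ y)
  ∷-≺ {a = a} (lex-prefix x t t≢[]) = lex-prefix (a ∷ x) t t≢[]
  ∷-≺ {a = a} (lex-diff r b c s t b<c) = lex-diff (a ∷ r) b c s t b<c

  <lex⇒≺ : x <lex y → x ≺ y
  <lex⇒≺ halt = lex-prefix [] (_ ∷ _) (λ ())
  <lex⇒≺ (this a<b) = lex-diff [] _ _ _ _ a<b
  <lex⇒≺ (next refl h) = ∷-≺ (<lex⇒≺ h)

  <lex-sandwich : x ≤p z → x <lex y → y <lex z → x ≤p y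
  <lex-sandwich {[]} {y = y} _ _ _ = y , refl
  <lex-sandwich {a ∷ x} (t , refl) (this a<b) (this b<a) = ⊥-elim (Fin.<-asym a<b b<a)
  <lex-sandwich {a ∷ x} (t , refl) (this a<b) (next refl _) = ⊥-elim (Fin.<-irrefl refl a<b)
  <lex-sandwich {a ∷ x} (t , refl) (next refl _) (this a<a) = ⊥-elim (Fin.<-irrefl refl a<a)
  <lex-sandwich {a ∷ x} (t , refl) (next refl h) (next refl h′) =
    ∷-≤p (<lex-sandwich (t , refl) h h′)

  ++-<lex⁻ : ∀ s → (s ++ u) <lex x → s <lex x ⊎ s ≤p x
  ++-<lex⁻ {x = x} [] _ = inj₂ (x , refl)
  ++-<lex⁻ (a ∷ s) (this h) = inj₁ (this h)
  ++-<lex⁻ (a ∷ s) (next refl h) = Sum.map (next refl) ∷-≤p (++-<lex⁻ s h)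

  <lex-truncate : s <lex x → y ≤p x → s <lex y ⊎ y ≤p s
  <lex-truncate {s} {y = []} _ _ = inj₂ (s , refl)
  <lex-truncate {y = b ∷ y} halt _ = inj₁ halt
  <lex-truncate {y = b ∷ y} (this h) (t , refl) = inj₁ (this h)
  <lex-truncate {y = b ∷ y} (next refl h) (t , refl) =
    Sum.map (next refl) ∷-≤p (<lex-truncate h (t , refl))

  ≺-mismatch : x ≺ y → ¬ ProperPrefix x y → ∀ u → y ≺in (x ++ u)
  ≺-mismatch (lex-prefix x t t≢[]) ¬pp _ = ⊥-elim (¬pp (t , t≢[] , refl))
  ≺-mismatch (lex-diff r a b s t a<b) _ u =
    subst ((r ++ b ∷ t) ≺in_) (sym (++-assoc r (a ∷ s) u)) (lex-diff r b a t (s ++ u) a<b)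

  ≤p⇒⪰in : x ≤p y → y ⪰in x
  ≤p⇒⪰in {x} ([] , y≡x[]) = inj₂ (trans y≡x[] (++-identityʳ x))
  ≤p⇒⪰in {x} (d ∷ t , refl) = inj₁ (lex-prefix x (d ∷ t) (λ ()))

  <lex-restrict-to-prefix : s <lex x ⊎ s ≤p x → y ≤p x → ProperSuffix s y → s <lex y
  <lex-restrict-to-prefix (inj₁ s<x) y≤x ps with <lex-truncate s<x y≤x
  ... | inj₁ s<y = s<y
  ... | inj₂ y≤s = ⊥-elim (ProperSuffix⇒≰p ps y≤s)
  <lex-restrict-to-prefix {s} (inj₂ s≤x) y≤x ps@(c , _ , y≡cs) with ≤s⇒≤p (c , y≡cs) y≤x s≤x
  ... | [] , y≡s[] =
    ⊥-elim (ProperSuffix⇒≰p ps (subst (_≤p s) (sym (trans y≡s[] (++-identityʳ s))) (≤p-refl s)))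
  ... | d ∷ t , refl = ++-<lex s (λ ())

  invLyndon-suffix : InvLyndon x → ProperSuffix s x → s ≢ [] → s <lex x
  invLyndon-suffix (_ , suffix<) ps s≢[] = ≺⇒<lex (suffix< _ s≢[] ps)

  invLyndon-prefix : InvLyndon (y ++ z) → y ≢ [] → InvLyndon y
  invLyndon-prefix {y} {z} I y≢[] = y≢[] , suffix<
    where
    suffix< : ∀ s → s ≢ [] → ProperSuffix s y → s ≺ y
    suffix< s s≢[] ps@(c , c≢[] , y≡cs) =
      <lex⇒≺ (<lex-restrict-to-prefix
                (++-<lex⁻ s (invLyndon-suffix I (c , c≢[] , yz≡csz) (s≢[] ∘ ++-conicalˡ s z)))
                (z , refl) ps)
      where
      yz≡csz : y ++ z ≡ c ++ (s ++ z)
      yz≡csz = trans (cong (_++ z) y≡cs) (++-assoc c s z)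

  invLyndon-border : InvLyndon x → z ≢ [] → z ≤p x → z ≤s x → InvLyndon z
  invLyndon-border {x} {z} I z≢[] z≤x (y , x≡yz) = z≢[] , suffix<
    where
    suffix< : ∀ s → s ≢ [] → ProperSuffix s z → s ≺ z
    suffix< s s≢[] ps@(c , c≢[] , z≡cs) =
      <lex⇒≺ (<lex-restrict-to-prefix
                (inj₁ (invLyndon-suffix I (y ++ c , c≢[] ∘ ++-conicalʳ y c , x≡ycs) s≢[]))
                z≤x ps)
      where
      x≡ycs : x ≡ (y ++ c) ++ s
      x≡ycs = trans x≡yz (trans (cong (y ++_) z≡cs) (sym (++-assoc y c s)))

  concat-replicate-comm : ∀ k (x : Word) → x ++ concat (replicate k x) ≡ concat (replicate k x) ++ x
  concat-replicate-comm zero x = ++-identityʳ x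
  concat-replicate-comm (suc k) x =
    trans (cong (x ++_) (concat-replicate-comm k x)) (sym (++-assoc x _ x))

  concat-replicate-[] : ∀ k → concat (replicate k []) ≡ [] {A = Letter}
  concat-replicate-[] zero = refl
  concat-replicate-[] (suc k) = concat-replicate-[] k

  unbordered-invLyndon⇒antiLyndon : Unbordered w → InvLyndon w → AntiLyndon w
  unbordered-invLyndon⇒antiLyndon {w} U@(w≢[] , _) (_ , suffix<) = (w≢[] , not-power) , conjugate
    where
    not-power : ¬ (Σ Word λ x → Σ ℕ λ k → k ≥ 2 × w ≡ concat (replicate k x))
    not-power (_ , zero , () , _)
    not-power (_ , suc zero , s≤s () , _)
    not-power ([] , suc (suc k) , _ , w≡[]ᵏ) = w≢[] (trans w≡[]ᵏ (concat-replicate-[] k))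
    not-power (x@(_ ∷ _) , suc (suc k) , _ , w≡xᵏ) =
      unbordered-prefix-¬properSuffix U (λ ()) (x , trans w≡xᵏ (concat-replicate-comm (suc k) x))
                                      (x , (λ ()) , w≡xᵏ)

    conjugate : ∀ u v → w ≡ u ++ v → v ++ u ≢ w → w ≺in (v ++ u)
    conjugate [] v w≡v vu≢w = ⊥-elim (vu≢w (trans (++-identityʳ v) (sym w≡v)))
    conjugate u@(_ ∷ _) [] w≡u[] vu≢w = ⊥-elim (vu≢w (trans (sym (++-identityʳ u)) (sym w≡u[])))
    conjugate u@(_ ∷ _) v@(_ ∷ _) w≡uv _ =
      ≺-mismatch (suffix< v (λ ()) v-suffix)
                 (λ (t , _ , w≡vt) → unbordered-prefix-¬properSuffix U (λ ()) (t , w≡vt) v-suffix) u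
      where
      v-suffix : ProperSuffix v w
      v-suffix = u , (λ ()) , w≡uv

  -- The last term of NB(x), characterised as an unbordered word that is a prefix and a suffix of x.
  LastNB : Word → Word → Set
  LastNB x z = Unbordered z × z ≤p x × z ≤s x

  lastNB-border : m ≢ [] → m ≤p x → m ≤s x → LastNB x z → LastNB m z
  lastNB-border m≢[] m≤x m≤sx (Uz , z≤x , z≤sx) with ≤s-total z≤sx m≤sx
  ... | inj₁ z≤sm = Uz , ≤s⇒≤p z≤sm m≤x z≤x , z≤sm
  ... | inj₂ ([] , refl) = Uz , ≤p-refl _ , ≤s-refl _
  ... | inj₂ (d ∷ c , z≡dcm) =
    ⊥-elim (unbordered-prefix-¬properSuffix Uz m≢[] (≤s⇒≤p (d ∷ c , z≡dcm) z≤x m≤x)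
                                            (d ∷ c , (λ ()) , z≡dcm))

  invLyndon-prefix-shift : InvLyndon x → x ≡ c ++ S → c ≢ [] → S ≢ [] →
                           z ≤p x → (c ++ z) ≤s x → z ≤p S
  invLyndon-prefix-shift {c = c} {S} {z} _ x≡cS _ _ _ ([] , x≡cz) =
    subst (z ≤p_) (++-cancelˡ c z S (trans (sym x≡cz) x≡cS)) (≤p-refl z)
  invLyndon-prefix-shift {x} {c} {S} {z} I x≡cS c≢[] S≢[] z≤x (d ∷ y , x≡ycz) =
    <lex-sandwich z≤x z<S S<x
    where
    z<S : z <lex S
    z<S = <lex-cancelˡ c (subst ((c ++ z) <lex_) x≡cS
            (invLyndon-suffix I (d ∷ y , (λ ()) , x≡ycz) (c≢[] ∘ ++-conicalˡ c z)))
    S<x : S <lex x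
    S<x = invLyndon-suffix I (c , c≢[] , x≡cS) S≢[]

  invLyndon-⪰in-unbordered-prefix : InvLyndon x → Unbordered z → z ≤p x →
                                    z′ ≢ [] → z′ ≤p x → (z′ ++ z) ≤s x → z′ ⪰in z
  invLyndon-⪰in-unbordered-prefix {z = z} {z′} I Uz (u , x≡zu) z′≢[] z′≤x z′z≤sx
    with ≤p-total (u , x≡zu) z′≤x
  ... | inj₁ z≤z′ = ≤p⇒⪰in z≤z′
  ... | inj₂ ([] , z≡z′[]) = inj₂ (sym (trans z≡z′[] (++-identityʳ z′)))
  ... | inj₂ (d ∷ t , z≡z′dt) =
    ⊥-elim (unbordered-prefix-¬properSuffix Uz (λ ()) dt≤z (z′ , z′≢[] , z≡z′dt))
    where
    z≤dtu : z ≤p (d ∷ t ++ u)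
    z≤dtu = invLyndon-prefix-shift I (trans x≡zu (trans (cong (_++ u) z≡z′dt) (++-assoc z′ (d ∷ t) u)))
                                   z′≢[] (λ ()) (u , x≡zu) z′z≤sx
    dt≤z : (d ∷ t) ≤p z
    dt≤z = ≤s⇒≤p (z′ , z≡z′dt) z≤dtu (u , refl)

  nonIncr-join : ∀ ws′ → NonIncrIn (ws′ ∷ʳ x) → NonIncrIn (x ∷ ws) → NonIncrIn (ws′ ++ x ∷ ws)
  nonIncr-join [] _ N = N
  nonIncr-join (_ ∷ []) (cons _ _ _ h _) N = cons _ _ _ h N
  nonIncr-join (_ ∷ d ∷ s) (cons _ _ _ h N′) N = cons _ _ _ h (nonIncr-join (d ∷ s) N′ N)

  nb-concat : NBRel x ws → concat ws ≡ x
  nb-concat (nb-unb x _) = ++-identityʳ x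
  nb-concat (nb-bor _ y z s _ _ _ refl _ nb) =
    trans (sym (concat-++ s [ z ])) (cong₂ _++_ (nb-concat nb) (++-identityʳ z))

  nb-head : NBRel x ws → ∃₂ λ f ws′ → ws ≡ f ∷ ws′ × f ≤p x
  nb-head (nb-unb x _) = x , [] , refl , ≤p-refl x
  nb-head (nb-bor _ y z _ _ _ _ refl _ nb) with nb-head nb
  ... | f , s′ , refl , f≤y = f , s′ ∷ʳ z , refl , ≤p-trans f≤y (z , refl)

  nb-last : NBRel x ws → ∃₂ λ ws′ z → ws ≡ ws′ ∷ʳ z × LastNB x z
  nb-last (nb-unb x Ux) = [] , x , refl , Ux , ≤p-refl x , ≤s-refl x
  nb-last (nb-bor _ _ z s _ ((t , _ , x≡zt) , (u , _ , x≡uz)) Uz _ _ _) =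
    s , z , refl , Uz , (t , x≡zt) , (u , x≡uz)

  nb-antiLyndon : InvLyndon x → NBRel x ws → All AntiLyndon ws
  nb-antiLyndon I (nb-unb x Ux) = unbordered-invLyndon⇒antiLyndon Ux I ∷ []
  nb-antiLyndon I (nb-bor _ y z s _ ((t , _ , yz≡zt) , _) Uz refl y≢[] nb) =
    ++⁺ (nb-antiLyndon (invLyndon-prefix I y≢[]) nb)
        (unbordered-invLyndon⇒antiLyndon Uz (invLyndon-border I (proj₁ Uz) (t , yz≡zt) (y , refl)) ∷ [])

  nb-nonIncr : InvLyndon x → NBRel x ws → NonIncrIn ws
  nb-nonIncr I (nb-unb x _) = one x
  nb-nonIncr I (nb-bor _ y z s _ ((t , _ , yz≡zt) , _) Uz refl y≢[] nb) with nb-last nb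
  ... | s′ , z′ , refl , (Uz′ , z′≤y , (y′ , y≡y′z′)) =
    subst NonIncrIn (sym (++-assoc s′ [ z′ ] [ z ]))
      (nonIncr-join s′ (nb-nonIncr (invLyndon-prefix I y≢[]) nb) (cons z′ z [] z′⪰z (one z)))
    where
    z′⪰z : z′ ⪰in z
    z′⪰z = invLyndon-⪰in-unbordered-prefix I Uz (t , yz≡zt) (proj₁ Uz′) (≤p-trans z′≤y (z , refl))
             (y′ , trans (cong (_++ z) y≡y′z′) (++-assoc y′ z′ z))

  boundedRightExt-shape : BoundedRightExt p v p̄ → p̄ ≡ r ∷ʳ b →
                          ∃₂ λ a t → p ≡ r ++ a ∷ t × a <ₗ b
  boundedRightExt-shape (_ , _ , _ , _ , _ , _ , _ , lex-prefix _ t t≢[] , ¬pp) _ =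
    ⊥-elim (¬pp (t , t≢[] , refl))
  boundedRightExt-shape (_ , _ , _ , _ , _ , _ , _ , lex-diff c a b′ s [] a<b′ , _) cb′≡rb
    with ∷ʳ-injective c _ cb′≡rb
  ... | refl , refl = a , s , refl , a<b′
  boundedRightExt-shape (_ , _ , _ , ext , _ , p≢[] , _ , lex-diff c a b′ s (d ∷ t) a<b′ , _) _ =
    ⊥-elim (<lex-asym cb′<pcb′ pcb′<cb′)
    where
    I : InvLyndon ((c ++ a ∷ s) ++ c ∷ʳ b′)
    I = ext (c ∷ʳ b′) (∷ʳ≢[] c) (d ∷ t , (λ ()) , sym (++-assoc c [ b′ ] (d ∷ t)))
    cb′<pcb′ : (c ∷ʳ b′) <lex ((c ++ a ∷ s) ++ c ∷ʳ b′)
    cb′<pcb′ = invLyndon-suffix I (c ++ a ∷ s , p≢[] , refl) (∷ʳ≢[] c)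
    pcb′<cb′ : ((c ++ a ∷ s) ++ c ∷ʳ b′) <lex (c ∷ʳ b′)
    pcb′<cb′ =
      subst (_<lex (c ∷ʳ b′)) (sym (++-assoc c (a ∷ s) (c ∷ʳ b′))) (<lex-++ˡ c (this a<b′))

  -- With r = z u, the inverse Lyndon words r b and p r give r < u a t r < u b < r b, so r is a
  -- prefix of u b; but r is longer than u and r < u b.
  short-prefix-¬properSuffix : p ≡ r ++ a ∷ t → a <ₗ b → InvLyndon (r ∷ʳ b) → InvLyndon (p ++ r) →
                               z ≢ [] → z ≤p r → ¬ ProperSuffix z p
  short-prefix-¬properSuffix {p} {r} {a} {t} {b} {z} p≡rat a<b I-rb I-pr z≢[] (u , r≡zu)
                             (y , y≢[] , p≡yz) =
    Sum.[ ProperSuffix⇒≰p (z , z≢[] , r≡zu) , (λ r≡ub → <lex-irrefl (subst (r <lex_) (sym r≡ub) r<ub)) ]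
      (≤p-∷ʳ (<lex-sandwich ([ b ] , refl) r<ub ub<rb))
    where
    pr≡zuatr : p ++ r ≡ z ++ (u ++ a ∷ (t ++ r))
    pr≡zuatr = begin
      p ++ r                    ≡⟨ cong (_++ r) p≡rat ⟩
      (r ++ a ∷ t) ++ r         ≡⟨ ++-assoc r (a ∷ t) r ⟩
      r ++ a ∷ (t ++ r)         ≡⟨ cong (_++ a ∷ (t ++ r)) r≡zu ⟩
      (z ++ u) ++ a ∷ (t ++ r)  ≡⟨ ++-assoc z u (a ∷ (t ++ r)) ⟩
      z ++ (u ++ a ∷ (t ++ r))  ∎
      where open ≡-Reasoning
    r<uatr : r <lex (u ++ a ∷ (t ++ r))
    r<uatr = <lex-cancelˡ z (subst ((z ++ r) <lex_) pr≡zuatr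
               (invLyndon-suffix I-pr (y , y≢[] , trans (cong (_++ r) p≡yz) (++-assoc y z r))
                                 (z≢[] ∘ ++-conicalˡ z r)))
    r<ub : r <lex (u ∷ʳ b)
    r<ub = <lex-trans r<uatr (<lex-++ˡ u (this a<b))
    ub<rb : (u ∷ʳ b) <lex (r ∷ʳ b)
    ub<rb = invLyndon-suffix I-rb (z , z≢[] , trans (cong (_∷ʳ b) r≡zu) (++-assoc z u [ b ]))
                             (∷ʳ≢[] u)

  lastNB-extends : p ≡ r ++ a ∷ t → a <ₗ b → InvLyndon (r ∷ʳ b) →
                   (∀ z′ → z′ ≢ [] → ProperPrefix z′ (r ∷ʳ b) → InvLyndon (p ++ z′)) →
                   LastNB p z → (r ∷ʳ a) ≤p z
  lastNB-extends p≡rat _ _ _ (_ , _ , ([] , p≡z)) = subst (_ ≤p_) p≡z (∷ʳ-≤p p≡rat)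
  lastNB-extends {r = r} p≡rat a<b I-rb ext ((z≢[] , _) , z≤p , (d ∷ y , p≡dyz))
    with ≤p-total z≤p (∷ʳ-≤p p≡rat)
  ... | inj₂ ra≤z = ra≤z
  ... | inj₁ z≤ra with ≤p-∷ʳ z≤ra
  ...   | inj₂ refl = ≤p-refl _
  ...   | inj₁ z≤r@(u , r≡zu) =
    ⊥-elim (short-prefix-¬properSuffix p≡rat a<b I-rb (ext r r≢[] (≤p⇒ProperPrefix-∷ʳ (≤p-refl r)))
                                       z≢[] z≤r (d ∷ y , (λ ()) , p≡dyz))
    where
    r≢[] : r ≢ []
    r≢[] r≡[] = z≢[] (++-conicalˡ _ u (trans (sym r≡zu) r≡[]))

  ∷ʳ-mismatch : a <ₗ b → (r ∷ʳ a) ≤p z → (r ∷ʳ b) ≤p f → f ≺in z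
  ∷ʳ-mismatch {a} {b} {r} a<b (e , refl) (g , refl) =
    subst₂ _≺in_ (sym (++-assoc r [ b ] g)) (sym (++-assoc r [ a ] e)) (lex-diff r b a g e a<b)

  ⪰in-prefixes : a <ₗ b → (r ∷ʳ a) ≤p z → (r ∷ʳ b) ≤p m → f ≤p m → z ⪰in f
  ⪰in-prefixes {a} a<b ra≤z rb≤m f≤m with ≤p-total rb≤m f≤m
  ... | inj₁ rb≤f = inj₁ (∷ʳ-mismatch a<b ra≤z rb≤f)
  ... | inj₂ f≤rb with ≤p-∷ʳ f≤rb
  ...   | inj₁ f≤r = ≤p⇒⪰in (≤p-trans f≤r (≤p-trans ([ a ] , refl) ra≤z))
  ...   | inj₂ refl = inj₁ (∷ʳ-mismatch a<b ra≤z (≤p-refl _))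

  -- As the first term of NB(y) is a prefix of y, this compares the last term of NB(x) with it.
  LastNBDominates : Word → Word → Set
  LastNBDominates x y = ∀ {z f} → LastNB x z → f ≤p y → z ⪰in f

  icfl-factors : ICFLRel w ms → All InvLyndon ms × Linked LastNBDominates ms × concat ms ≡ w
  icfl-factors (icfl-inv w I) = I ∷ [] , [-] , ++-identityʳ w
  icfl-factors (icfl-sep _ p _ _ r b m₁ ms (_ , refl , _ , _ , I-p , bre@(_ , _ , I-rb , ext , _))
                        refl R rb≤m₁)
    with icfl-factors R | boundedRightExt-shape bre refl
  ... | invs , links , refl | a , t , p≡rat , a<b = I-p ∷ invs , dominates ∷ links , refl
    where
    dominates : LastNBDominates p m₁
    dominates last f≤m₁ = ⪰in-prefixes a<b (lastNB-extends p≡rat a<b I-rb ext last) rb≤m₁ f≤m₁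
  icfl-factors (icfl-glue _ p _ _ r b m₁ ms (_ , refl , _ , _ , _ , bre@(_ , _ , _ , ext , _))
                         refl R m₁≤r)
    with icfl-factors R | boundedRightExt-shape bre refl
  ... | I-m₁ ∷ invs , links , refl | a , t , p≡rat , _ =
    ext m₁ (proj₁ I-m₁) (≤p⇒ProperPrefix-∷ʳ m₁≤r) ∷ invs , relink links , ++-assoc p m₁ (concat ms)
    where
    m₁≤pm₁ : m₁ ≤p (p ++ m₁)
    m₁≤pm₁ = ≤p-trans m₁≤r (≤p-trans ([ a ] , refl) (≤p-trans (∷ʳ-≤p p≡rat) (m₁ , refl)))
    relink : Linked LastNBDominates (m₁ ∷ ms) → Linked LastNBDominates ((p ++ m₁) ∷ ms)
    relink [-] = [-]
    relink (dominates ∷ links) =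
      (λ last → dominates (lastNB-border (proj₁ I-m₁) m₁≤pm₁ (p , refl) last)) ∷ links

  concat-nbs : Pointwise NBRel ms wss → concat (concat wss) ≡ concat ms
  concat-nbs [] = refl
  concat-nbs {wss = ws ∷ wss} (nb ∷ nbs) =
    trans (sym (concat-++ ws (concat wss))) (cong₂ _++_ (nb-concat nb) (concat-nbs nbs))

  nbs-antiLyndon : All InvLyndon ms → Pointwise NBRel ms wss → All AntiLyndon (concat wss)
  nbs-antiLyndon [] [] = []
  nbs-antiLyndon (I ∷ invs) (nb ∷ nbs) = ++⁺ (nb-antiLyndon I nb) (nbs-antiLyndon invs nbs)

  nbs-nonIncr : All InvLyndon ms → Linked LastNBDominates ms → Pointwise NBRel ms wss →
                NonIncrIn (concat wss)
  nbs-nonIncr [] [] [] = nil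
  nbs-nonIncr (I ∷ []) [-] (nb ∷ []) = subst NonIncrIn (sym (++-identityʳ _)) (nb-nonIncr I nb)
  nbs-nonIncr (I ∷ invs) (dominates ∷ links) (nb ∷ nb′ ∷ nbs) with nb-last nb | nb-head nb′
  ... | ws , z , refl , last | f , ws′ , refl , f≤m′ =
    subst NonIncrIn (sym (++-assoc ws [ z ] _))
      (nonIncr-join ws (nb-nonIncr I nb)
                    (cons z f _ (dominates last f≤m′) (nbs-nonIncr invs links (nb′ ∷ nbs))))

open Words

corollary8p11 : (n : ℕ) (w : Word n) → w ≢ [] →
    (ms : List (Word n)) → ICFLRel n w ms →
    (nbs : List (List (Word n))) → Pointwise (NBRel n) ms nbs →
    IsCFLin n w (concat nbs)
corollary8p11 n w _ ms icfl nbs pw =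
  let invs , links , concat-ms≡w = icfl-factors icfl
  in nbs-antiLyndon invs pw , trans (concat-nbs pw) concat-ms≡w , nbs-nonIncr invs links pw
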